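{- Let $G=(V,E)$ be a simple directed graph, where for each $v\in V$ the lists $\mathrm{In}(v)$ and $\mathrm{Out}(v)$ of incoming and outgoing edges have an arbitrary fixed ordering, and let $\Delta_v=\max(\mathrm{InDeg}(v),\mathrm{OutDeg}(v))$. Construct $\widetilde G$ as follows. For each $v$ with $\Delta_v>3$, replace $v$ by $\Delta_v$ new vertices $V_v=\{v_0,\dots,v_{\Delta_v-1}\}$ and add, for each $i$, the edges $(v_i,v_{(i+1)\bmod \Delta_v})$ and $(v_i,v_{(i-1)\bmod\Delta_v})$; for each $v$ with $\Delta_v\le 3$ let $V_v=\{v\}$ and $v_i=v$ for all $i$. For each edge $(u,v)\in E$ that is the $i$-th edge of $\mathrm{Out}(u)$ and the $j$-th edge of $\mathrm{In}(v)$, add the edge $(u_{i-1},v_{j-1})$ to $\widetilde G$. Then for every $S\subseteq V$, $G[S]$ is a 2-edge strongly connected component of $G$ if and only if $\widetilde G[\bigcup_{u\in S}V_u]$ is a 2-edge strongly connected component of $\widetilde G$.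
   Context: Two distinct vertices $u,v$ are 2-edge strongly connected in a graph if there are two edge-disjoint paths from $u$ to $v$ and two edge-disjoint paths from $v$ to $u$. The 2-edge strongly connected components of a graph are its maximal induced subgraphs in which every pair of distinct vertices is 2-edge strongly connected within the subgraph. -}

module Defs where

open import Level using (0ℓ)
open import Data.Nat using (ℕ; zero; suc; _+_; _∸_; _<_; _⊔_; _<ᵇ_)
open import Data.Nat.DivMod using (_mod_)
open import Data.Fin using (Fin; toℕ) renaming (_≟_ to _≟ᶠ_)
open import Data.Bool using (Bool; true; false; T; if_then_else_)
open import Data.List using (List; []; _∷_; map; length; filter; allFin)
open import Data.List.Membership.Propositional using (_∈_)
open import Data.List.Relation.Unary.Unique.Propositional using (Unique)
open import Data.Product using (Σ; Σ-syntax; _×_; _,_; proj₁; proj₂)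
open import Data.Sum using (_⊎_; inj₁; inj₂)
open import Data.Empty using (⊥)
open import Relation.Unary using (Pred; _⊆_)
open import Relation.Binary.PropositionalEquality using (_≡_; _≢_)

record Digraph : Set₁ where
  field
    V   : Set
    E   : Set
    src : E → V
    tgt : E → V

module _ (G : Digraph) where
  open Digraph G

  IsWalk : Pred V 0ℓ → V → V → List E → Set
  IsWalk S u v []       = u ≡ v
  IsWalk S u v (e ∷ es) = src e ≡ u × S (src e) × S (tgt e) × IsWalk S (tgt e) v es

  IsPath : Pred V 0ℓ → V → V → List E → Set
  IsPath S u v es = IsWalk S u v es × Unique (u ∷ map tgt es)

  EdgeDisjoint : List E → List E → Set
  EdgeDisjoint es fs = ∀ e → e ∈ es → e ∈ fs → ⊥

  TwoEdgePaths : Pred V 0ℓ → V → V → Set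
  TwoEdgePaths S u v =
    Σ[ es ∈ List E ] Σ[ fs ∈ List E ]
      IsPath S u v es × IsPath S u v fs × EdgeDisjoint es fs

  Is2ESC : Pred V 0ℓ → Set
  Is2ESC S = ∀ u v → S u → S v → u ≢ v → TwoEdgePaths S u v × TwoEdgePaths S v u

  Is2ESCC : Pred V 0ℓ → Set₁
  Is2ESCC S = Is2ESC S × (∀ (T : Pred V 0ℓ) → S ⊆ T → Is2ESC T → T ⊆ S)

module Construction {n m : ℕ} (ends : Fin m → Fin n × Fin n)
                    (outPos inPos : Fin m → ℕ) where

  srcG tgtG : Fin m → Fin n
  srcG e = proj₁ (ends e)
  tgtG e = proj₂ (ends e)

  G : Digraph
  G = record { V = Fin n ; E = Fin m ; src = srcG ; tgt = tgtG }

  OutDeg InDeg Δ : Fin n → ℕ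
  OutDeg v = length (filter (λ e → srcG e ≟ᶠ v) (allFin m))
  InDeg  v = length (filter (λ e → tgtG e ≟ᶠ v) (allFin m))
  Δ v = OutDeg v ⊔ InDeg v

  big : Fin n → Bool
  big v = 3 <ᵇ Δ v

  -- |V_v| = k v  (written as suc of something so that it is visibly nonzero)
  -- k v = Δ v if Δ v > 3, and 1 otherwise.
  kpred : Fin n → ℕ
  kpred v = if big v then Δ v ∸ 1 else 0

  k : Fin n → ℕ
  k v = suc (kpred v)

  Ṽ : Set
  Ṽ = Σ[ v ∈ Fin n ] Fin (k v)

  -- edges of G̃ : cycle edges (v_i , v_{i±1}) for big v (Bool = direction),
  -- and one edge per original edge
  Ẽ : Set
  Ẽ = (Σ[ v ∈ Fin n ] T (big v) × Fin (k v) × Bool) ⊎ Fin m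

  -- v_i for an arbitrary index i ; when k v = 1 this is v_0 = v
  vtx : (v : Fin n) → ℕ → Ṽ
  vtx v i = v , (i mod k v)

  srcT tgtT : Ẽ → Ṽ
  srcT (inj₁ (v , _ , i , _))     = v , i
  srcT (inj₂ e)                   = vtx (srcG e) (outPos e)
  tgtT (inj₁ (v , _ , i , true))  = vtx v (toℕ i + 1)
  tgtT (inj₁ (v , _ , i , false)) = vtx v (toℕ i + kpred v)   -- (i - 1) mod k v
  tgtT (inj₂ e)                   = vtx (tgtG e) (inPos e)

  G̃ : Digraph
  G̃ = record { V = Ṽ ; E = Ẽ ; src = srcT ; tgt = tgtT }

  lift : Pred (Fin n) 0ℓ → Pred Ṽ 0ℓ
  lift S x = S (proj₁ x)

-- Hypotheses: G simple, and outPos / inPos are fixed orderings of Out(v),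
-- In(v) (0-based positions: the i-th edge, 1-based, has position i-1).

module _ {n m : ℕ} (ends : Fin m → Fin n × Fin n) where
  open Construction ends (λ _ → 0) (λ _ → 0) using (srcG; tgtG; OutDeg; InDeg)

  IsSimple : Set
  IsSimple = (∀ e f → ends e ≡ ends f → e ≡ f) × (∀ e → srcG e ≢ tgtG e)

  IsOutOrdering : (Fin m → ℕ) → Set
  IsOutOrdering pos = (∀ e → pos e < OutDeg (srcG e))
                    × (∀ e f → srcG e ≡ srcG f → pos e ≡ pos f → e ≡ f)

  IsInOrdering : (Fin m → ℕ) → Set
  IsInOrdering pos = (∀ e → pos e < InDeg (tgtG e))
                   × (∀ e f → tgtG e ≡ tgtG f → pos e ≡ pos f → e ≡ f)

-- Contracting each V_v to v sends a walk of G̃ inside ⋃_{u∈S} V_u to the walk of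
-- G inside S formed by the original edges it uses, so edge-disjoint walks stay
-- edge-disjoint. Conversely a walk of G lifts to G̃ by going round the cycle V_v
-- from the port where it enters v to the port where it leaves; lifting one walk
-- clockwise and the other counterclockwise keeps them edge-disjoint, and the same
-- cycles connect two copies of one vertex. Since edge-disjoint walks shorten to
-- edge-disjoint paths, S is 2-edge strongly connected in G iff ⋃_{u∈S} V_u is in
-- G̃, and maximality transfers because S ↦ ⋃_{u∈S} V_u and T ↦ {v | T meets V_v}
-- form a Galois connection.
module Submission where

open import Defs
open import Level using (0ℓ)
open import Data.Nat using (ℕ; zero; suc; _+_; _∸_; _%_)
open import Data.Nat.Properties using (+-assoc; +-comm; +-suc; m∸n+n≡m; <⇒≤)
open import Data.Nat.DivMod using (_mod_; %-distribˡ-+; m%n%n≡m%n; [m+n]%n≡m%n; m<n⇒m%n≡m)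
open import Data.Fin using (Fin; toℕ; _≟_) renaming (zero to fzero)
open import Data.Fin.Properties using (toℕ-fromℕ<; toℕ-injective; toℕ<n)
open import Data.Bool using (Bool; true; false; T)
open import Data.Unit using (tt)
open import Data.Empty using (⊥)
open import Data.List using (List; []; _∷_; map; _++_)
open import Data.List.Membership.Propositional using (_∈_)
open import Data.List.Relation.Unary.Any using (here; there)
open import Data.List.Relation.Unary.All as All using (All; []; _∷_)
open import Data.List.Relation.Unary.All.Properties using (++⁺; ¬Any⇒All¬)
open import Data.List.Relation.Unary.AllPairs using ([]; _∷_)
open import Data.List.Relation.Unary.Unique.Propositional using (Unique)
import Data.List.Relation.Binary.Subset.Propositional as List
import Data.List.Membership.DecPropositional as DecMembership
open import Data.Product using (Σ; Σ-syntax; _×_; _,_; proj₁; proj₂)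
open import Data.Product.Properties using (≡-dec)
open import Data.Sum using (_⊎_; inj₁; inj₂)
open import Function.Bundles using (_⇔_; mk⇔)
open import Relation.Binary.Definitions using (DecidableEquality)
open import Relation.Binary.PropositionalEquality
  using (_≡_; _≢_; refl; sym; trans; cong; subst; subst₂; module ≡-Reasoning)
open import Relation.Nullary using (yes; no)
open import Relation.Unary using (Pred; _⊆_; _≐_)

module Walks (G : Digraph) where
  open Digraph G

  WalkWithin : Pred V 0ℓ → Pred E 0ℓ → V → V → Set
  WalkWithin S P u v = Σ[ es ∈ List E ] IsWalk G S u v es × All P es

  TwoEdgeWalks : Pred V 0ℓ → V → V → Set
  TwoEdgeWalks S u v =
    Σ[ es ∈ List E ] Σ[ fs ∈ List E ]
      IsWalk G S u v es × IsWalk G S u v fs × EdgeDisjoint G es fs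

  TwoEdgeWalks-refl : ∀ {S u} → TwoEdgeWalks S u u
  TwoEdgeWalks-refl = [] , [] , refl , refl , λ _ ()

  Is2ESCʷ : Pred V 0ℓ → Set
  Is2ESCʷ S = ∀ u v → S u → S v → u ≢ v → TwoEdgeWalks S u v × TwoEdgeWalks S v u

  module _ {S : Pred V 0ℓ} {P : Pred E 0ℓ} where

    IsWalk-++ : ∀ {u v w} es fs → IsWalk G S u v es → IsWalk G S v w fs → IsWalk G S u w (es ++ fs)
    IsWalk-++ []       fs refl             ws = ws
    IsWalk-++ (e ∷ es) fs (p , a , b , ws) ws′ = p , a , b , IsWalk-++ es fs ws ws′

    WalkWithin-refl : ∀ {u} → WalkWithin S P u u
    WalkWithin-refl = [] , refl , []

    WalkWithin-trans : ∀ {u v w} → WalkWithin S P u v → WalkWithin S P v w → WalkWithin S P u w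
    WalkWithin-trans (es , ws , ps) (fs , ws′ , ps′) = es ++ fs , IsWalk-++ es fs ws ws′ , ++⁺ ps ps′

    WalkWithin-edge : ∀ e → S (src e) → S (tgt e) → P e → WalkWithin S P (src e) (tgt e)
    WalkWithin-edge e a b p = e ∷ [] , (refl , a , b , refl) , p ∷ []

    WalkWithin-ascending : (f : ℕ → V) → (∀ b → WalkWithin S P (f b) (f (suc b)))
                         → ∀ d a → WalkWithin S P (f a) (f (d + a))
    WalkWithin-ascending f step zero    a = WalkWithin-refl
    WalkWithin-ascending f step (suc d) a = WalkWithin-trans (WalkWithin-ascending f step d a) (step (d + a))

    WalkWithin-descending : (f : ℕ → V) → (∀ b → WalkWithin S P (f (suc b)) (f b))
                          → ∀ d a → WalkWithin S P (f (d + a)) (f a)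
    WalkWithin-descending f step zero    a = WalkWithin-refl
    WalkWithin-descending f step (suc d) a = WalkWithin-trans (step (d + a)) (WalkWithin-descending f step d a)

  WalkWithin-map : ∀ {S P Q u v} → P ⊆ Q → WalkWithin S P u v → WalkWithin S Q u v
  WalkWithin-map P⊆Q (es , ws , ps) = es , ws , All.map P⊆Q ps

  All-disjoint : ∀ {P Q : Pred E 0ℓ} → (∀ {e} → P e → Q e → ⊥)
               → ∀ {es fs} → All P es → All Q fs → EdgeDisjoint G es fs
  All-disjoint P∩Q=∅ ps qs e e∈es e∈fs = P∩Q=∅ (All.lookup ps e∈es) (All.lookup qs e∈fs)

  WalkWithin-disjoint : ∀ {S} {P Q : Pred E 0ℓ} {u v} → (∀ {e} → P e → Q e → ⊥)
                      → WalkWithin S P u v → WalkWithin S Q u v → TwoEdgeWalks S u v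
  WalkWithin-disjoint P∩Q=∅ (es , ws , ps) (fs , ws′ , qs) = es , fs , ws , ws′ , All-disjoint P∩Q=∅ ps qs

  IsWalk-mono : ∀ {S S′ : Pred V 0ℓ} {u v} → S ⊆ S′ → ∀ es → IsWalk G S u v es → IsWalk G S′ u v es
  IsWalk-mono S⊆S′ []       ws               = ws
  IsWalk-mono S⊆S′ (e ∷ es) (p , a , b , ws) = p , S⊆S′ a , S⊆S′ b , IsWalk-mono S⊆S′ es ws

  TwoEdgePaths-mono : ∀ {S S′ : Pred V 0ℓ} {u v} → S ⊆ S′ → TwoEdgePaths G S u v → TwoEdgePaths G S′ u v
  TwoEdgePaths-mono S⊆S′ (es , fs , (ws , ues) , (ws′ , ufs) , disjoint) =
    es , fs , (IsWalk-mono S⊆S′ es ws , ues) , (IsWalk-mono S⊆S′ fs ws′ , ufs) , disjoint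

  Is2ESC-resp-≐ : ∀ {S S′ : Pred V 0ℓ} → S ≐ S′ → Is2ESC G S → Is2ESC G S′
  Is2ESC-resp-≐ (S⊆S′ , S′⊆S) h u v su sv u≢v with h u v (S′⊆S su) (S′⊆S sv) u≢v
  ... | p , q = TwoEdgePaths-mono S⊆S′ p , TwoEdgePaths-mono S⊆S′ q

  Is2ESC⇒Is2ESCʷ : ∀ {S} → Is2ESC G S → Is2ESCʷ S
  Is2ESC⇒Is2ESCʷ h u v su sv u≢v with h u v su sv u≢v
  ... | (es , fs , (ws , _) , (ws′ , _) , d) , (es′ , fs′ , (vs , _) , (vs′ , _) , d′) =
    (es , fs , ws , ws′ , d) , (es′ , fs′ , vs , vs′ , d′)

  module _ (_≟ᵥ_ : DecidableEquality V) where
    open DecMembership _≟ᵥ_ using (_∈?_)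

    path-suffix : ∀ {S x v} u es → IsWalk G S x v es → Unique (x ∷ map tgt es) → u ∈ x ∷ map tgt es
                → Σ[ fs ∈ List E ] fs List.⊆ es × IsPath G S u v fs
    path-suffix u es       ws               uniq       (here refl) = es , (λ e∈ → e∈) , ws , uniq
    path-suffix u (e ∷ es) (_ , _ , _ , ws) (_ ∷ uniq) (there u∈) with path-suffix u es ws uniq u∈
    ... | fs , fs⊆es , path = fs , (λ e∈ → there (fs⊆es e∈)) , path

    walk⇒path : ∀ {S u v} es → IsWalk G S u v es → Σ[ fs ∈ List E ] fs List.⊆ es × IsPath G S u v fs
    walk⇒path []       refl = [] , (λ ()) , refl , [] ∷ []
    walk⇒path {u = u} (e ∷ es) (p , a , b , ws) with walk⇒path es ws
    ... | fs , fs⊆es , ws′ , uniq with u ∈? tgt e ∷ map tgt fs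
    ...   | no u∉ = e ∷ fs , e∷fs⊆ , (p , a , b , ws′) , ¬Any⇒All¬ _ u∉ ∷ uniq
      where
      e∷fs⊆ : e ∷ fs List.⊆ e ∷ es
      e∷fs⊆ (here eq)  = here eq
      e∷fs⊆ (there f∈) = there (fs⊆es f∈)
    ...   | yes u∈ with path-suffix u fs ws′ uniq u∈
    ...     | gs , gs⊆fs , path = gs , (λ g∈ → there (fs⊆es (gs⊆fs g∈))) , path

    TwoEdgeWalks⇒TwoEdgePaths : ∀ {S u v} → TwoEdgeWalks S u v → TwoEdgePaths G S u v
    TwoEdgeWalks⇒TwoEdgePaths (es , fs , ws , ws′ , disjoint) with walk⇒path es ws | walk⇒path fs ws′
    ... | gs , gs⊆es , p | hs , hs⊆fs , p′ =
      gs , hs , p , p′ , λ e e∈gs e∈hs → disjoint e (gs⊆es e∈gs) (hs⊆fs e∈hs)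

    Is2ESCʷ⇒Is2ESC : ∀ {S} → Is2ESCʷ S → Is2ESC G S
    Is2ESCʷ⇒Is2ESC h u v su sv u≢v with h u v su sv u≢v
    ... | p , q = TwoEdgeWalks⇒TwoEdgePaths p , TwoEdgeWalks⇒TwoEdgePaths q

Fin1-irrelevant : ∀ {p} → p ≡ 0 → (i j : Fin (suc p)) → i ≡ j
Fin1-irrelevant refl fzero fzero = refl

module CyclicIndex (p : ℕ) where
  open ≡-Reasoning

  K : ℕ
  K = suc p

  toℕ-mod : ∀ a → toℕ (a mod K) ≡ a % K
  toℕ-mod a = toℕ-fromℕ< _

  mod-cong-% : ∀ {a b} → a % K ≡ b % K → a mod K ≡ b mod K
  mod-cong-% {a} {b} eq = toℕ-injective (trans (toℕ-mod a) (trans eq (sym (toℕ-mod b))))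

  toℕ-mod-toℕ : (i : Fin K) → toℕ i mod K ≡ i
  toℕ-mod-toℕ i = toℕ-injective (trans (toℕ-mod (toℕ i)) (m<n⇒m%n≡m (toℕ<n i)))

  toℕ-mod-+ : ∀ a d → (toℕ (a mod K) + d) mod K ≡ (a + d) mod K
  toℕ-mod-+ a d = mod-cong-% {toℕ (a mod K) + d} {a + d} (begin
    (toℕ (a mod K) + d) % K  ≡⟨ cong (λ x → (x + d) % K) (toℕ-mod a) ⟩
    (a % K + d) % K          ≡⟨ %-distribˡ-+ (a % K) d K ⟩
    (a % K % K + d % K) % K  ≡⟨ cong (λ x → (x + d % K) % K) (m%n%n≡m%n a K) ⟩
    (a % K + d % K) % K      ≡⟨ %-distribˡ-+ a d K ⟨
    (a + d) % K              ∎)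

  +K-mod : ∀ a → (a + K) mod K ≡ a mod K
  +K-mod a = mod-cong-% {a + K} {a} ([m+n]%n≡m%n a K)

  -- Going up by j + (K ∸ i) from i, or down by i + (K ∸ j) to j, wraps exactly once.
  wrap : (i j : Fin K) → (toℕ j + (K ∸ toℕ i) + toℕ i) mod K ≡ j
  wrap i j = begin
    (toℕ j + (K ∸ toℕ i) + toℕ i) mod K  ≡⟨ cong (_mod K) (+-assoc (toℕ j) (K ∸ toℕ i) (toℕ i)) ⟩
    (toℕ j + (K ∸ toℕ i + toℕ i)) mod K  ≡⟨ cong (λ x → (toℕ j + x) mod K) (m∸n+n≡m (<⇒≤ (toℕ<n i))) ⟩
    (toℕ j + K) mod K                    ≡⟨ +K-mod (toℕ j) ⟩
    toℕ j mod K                          ≡⟨ toℕ-mod-toℕ j ⟩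
    j                                    ∎

module Lifting {n m : ℕ} (ends : Fin m → Fin n × Fin n) (outPos inPos : Fin m → ℕ) where
  open Construction ends outPos inPos
  private
    module W = Walks G
    module W̃ = Walks G̃

  _≟ṽ_ : DecidableEquality Ṽ
  _≟ṽ_ = ≡-dec _≟_ _≟_

  Lifted : Bool → List (Fin m) → Pred Ẽ 0ℓ
  Lifted d es (inj₁ (_ , _ , _ , d′)) = d′ ≡ d
  Lifted d es (inj₂ e)                = e ∈ es

  Lifted-∷ : ∀ {d e es} → Lifted d es ⊆ Lifted d (e ∷ es)
  Lifted-∷ {x = inj₁ _} d′≡d = d′≡d
  Lifted-∷ {x = inj₂ _} e∈es = there e∈es

  Lifted-disjoint : ∀ {es fs} → EdgeDisjoint G es fs → ∀ {x} → Lifted true es x → Lifted false fs x → ⊥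
  Lifted-disjoint disjoint {inj₁ _} refl ()
  Lifted-disjoint disjoint {inj₂ e} e∈es e∈fs = disjoint e e∈es e∈fs

  big-or-trivial : ∀ v → T (big v) ⊎ kpred v ≡ 0
  big-or-trivial v with big v
  ... | true  = inj₁ tt
  ... | false = inj₂ refl

  module _ {S : Pred (Fin n) 0ℓ} {es : List (Fin m)} where

    module _ {v} (sv : S v) (t : T (big v)) where
      open CyclicIndex (kpred v)
      open ≡-Reasoning

      clockwiseStep : ∀ b → W̃.WalkWithin (lift S) (Lifted true es) (vtx v b) (vtx v (suc b))
      clockwiseStep b =
        subst (W̃.WalkWithin (lift S) (Lifted true es) (vtx v b))
              (cong (v ,_) (trans (toℕ-mod-+ b 1) (cong (_mod K) (+-comm b 1))))
              (W̃.WalkWithin-edge (inj₁ (v , t , b mod K , true)) sv sv refl)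

      anticlockwiseStep : ∀ b → W̃.WalkWithin (lift S) (Lifted false es) (vtx v (suc b)) (vtx v b)
      anticlockwiseStep b =
        subst (W̃.WalkWithin (lift S) (Lifted false es) (vtx v (suc b)))
              (cong (v ,_) back)
              (W̃.WalkWithin-edge (inj₁ (v , t , suc b mod K , false)) sv sv refl)
        where
        back : (toℕ (suc b mod K) + kpred v) mod K ≡ b mod K
        back = begin
          (toℕ (suc b mod K) + kpred v) mod K  ≡⟨ toℕ-mod-+ (suc b) (kpred v) ⟩
          suc (b + kpred v) mod K              ≡⟨ cong (_mod K) (+-suc b (kpred v)) ⟨
          (b + K) mod K                        ≡⟨ +K-mod b ⟩
          b mod K                              ∎

      bigCycleWalk : (d : Bool) (i j : Fin K) → W̃.WalkWithin (lift S) (Lifted d es) (v , i) (v , j)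
      bigCycleWalk true i j =
        subst₂ (W̃.WalkWithin (lift S) (Lifted true es))
               (cong (v ,_) (toℕ-mod-toℕ i)) (cong (v ,_) (wrap i j))
               (W̃.WalkWithin-ascending (vtx v) clockwiseStep (toℕ j + (K ∸ toℕ i)) (toℕ i))
      bigCycleWalk false i j =
        subst₂ (W̃.WalkWithin (lift S) (Lifted false es))
               (cong (v ,_) (wrap j i)) (cong (v ,_) (toℕ-mod-toℕ j))
               (W̃.WalkWithin-descending (vtx v) anticlockwiseStep (toℕ i + (K ∸ toℕ j)) (toℕ j))

    cycleWalk : ∀ {v} → S v → (d : Bool) (i j : Fin (k v)) → W̃.WalkWithin (lift S) (Lifted d es) (v , i) (v , j)
    cycleWalk {v} sv d i j with big-or-trivial v
    ... | inj₁ t       = bigCycleWalk sv t d i j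
    ... | inj₂ trivial = [] , cong (v ,_) (Fin1-irrelevant trivial i j) , []

  liftWalk : ∀ {S} d {u w} es → IsWalk G S u w es → S u → (i : Fin (k u)) (j : Fin (k w))
           → W̃.WalkWithin (lift S) (Lifted d es) (u , i) (w , j)
  liftWalk d []       refl               su i j = cycleWalk su d i j
  liftWalk d (e ∷ es) (refl , a , b , ws) _  i j =
    W̃.WalkWithin-trans (cycleWalk a d i (outPos e mod k (srcG e)))
      (W̃.WalkWithin-trans (W̃.WalkWithin-edge (inj₂ e) a b (here refl))
        (W̃.WalkWithin-map Lifted-∷ (liftWalk d es ws b (inPos e mod k (tgtG e)) j)))

  lift-TwoEdgeWalks : ∀ {S u w} → S u → W.TwoEdgeWalks S u w
                    → (i : Fin (k u)) (j : Fin (k w)) → W̃.TwoEdgeWalks (lift S) (u , i) (w , j)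
  lift-TwoEdgeWalks su (es , fs , ws , ws′ , disjoint) i j =
    W̃.WalkWithin-disjoint (Lifted-disjoint disjoint) (liftWalk true es ws su i j) (liftWalk false fs ws′ su i j)

  lift-Is2ESCʷ : ∀ {S} → W.Is2ESCʷ S → W̃.Is2ESCʷ (lift S)
  lift-Is2ESCʷ h (u , i) (w , j) su sw _ with u ≟ w
  ... | yes refl = lift-TwoEdgeWalks su W.TwoEdgeWalks-refl i j , lift-TwoEdgeWalks su W.TwoEdgeWalks-refl j i
  ... | no u≢w with h u w su sw u≢w
  ...   | p , q = lift-TwoEdgeWalks su p i j , lift-TwoEdgeWalks sw q j i

  lift-Is2ESC : ∀ {S} → Is2ESC G S → Is2ESC G̃ (lift S)
  lift-Is2ESC h = W̃.Is2ESCʷ⇒Is2ESC _≟ṽ_ (lift-Is2ESCʷ (W.Is2ESC⇒Is2ESCʷ h))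

  collapse : Pred Ṽ 0ℓ → Pred (Fin n) 0ℓ
  collapse T v = Σ[ i ∈ Fin (k v) ] T (v , i)

  originalEdges : List Ẽ → List (Fin m)
  originalEdges []            = []
  originalEdges (inj₁ _ ∷ xs) = originalEdges xs
  originalEdges (inj₂ e ∷ xs) = e ∷ originalEdges xs

  ∈-originalEdges⁻ : ∀ {e} xs → e ∈ originalEdges xs → inj₂ e ∈ xs
  ∈-originalEdges⁻ (inj₁ _ ∷ xs) e∈          = there (∈-originalEdges⁻ xs e∈)
  ∈-originalEdges⁻ (inj₂ _ ∷ xs) (here refl) = here refl
  ∈-originalEdges⁻ (inj₂ _ ∷ xs) (there e∈)  = there (∈-originalEdges⁻ xs e∈)

  collapseWalk : ∀ T {x y} xs → IsWalk G̃ T x y xs → IsWalk G (collapse T) (proj₁ x) (proj₁ y) (originalEdges xs)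
  -- The cycle-edge case is split by direction only because tgtT computes once it is known.
  collapseWalk T []                              refl                = refl
  collapseWalk T (inj₁ (_ , _ , _ , true) ∷ xs)  (refl , _ , _ , ws) = collapseWalk T xs ws
  collapseWalk T (inj₁ (_ , _ , _ , false) ∷ xs) (refl , _ , _ , ws) = collapseWalk T xs ws
  collapseWalk T (inj₂ e ∷ xs)                   (refl , a , b , ws) = refl , (_ , a) , (_ , b) , collapseWalk T xs ws

  collapse-TwoEdgeWalks : ∀ {T x y} → W̃.TwoEdgeWalks T x y → W.TwoEdgeWalks (collapse T) (proj₁ x) (proj₁ y)
  collapse-TwoEdgeWalks {T} (xs , ys , ws , ws′ , disjoint) =
    originalEdges xs , originalEdges ys , collapseWalk T xs ws , collapseWalk T ys ws′ ,
    λ e e∈xs e∈ys → disjoint (inj₂ e) (∈-originalEdges⁻ xs e∈xs) (∈-originalEdges⁻ ys e∈ys)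

  collapse-Is2ESCʷ : ∀ {T} → W̃.Is2ESCʷ T → W.Is2ESCʷ (collapse T)
  collapse-Is2ESCʷ h u w (i , tu) (j , tw) u≢w with h (u , i) (w , j) tu tw (λ eq → u≢w (cong proj₁ eq))
  ... | p , q = collapse-TwoEdgeWalks p , collapse-TwoEdgeWalks q

  collapse-Is2ESC : ∀ {T} → Is2ESC G̃ T → Is2ESC G (collapse T)
  collapse-Is2ESC h = W.Is2ESCʷ⇒Is2ESC _≟_ (collapse-Is2ESCʷ (W̃.Is2ESC⇒Is2ESCʷ h))

  collapse-lift : ∀ S → collapse (lift S) ≐ S
  collapse-lift S = proj₂ , λ sv → fzero , sv

  collapse⊆⇒⊆lift : ∀ {S T} → collapse T ⊆ S → T ⊆ lift S
  collapse⊆⇒⊆lift T⊆S tx = T⊆S (_ , tx)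

  lift⊆⇒⊆collapse : ∀ {S T} → lift S ⊆ T → S ⊆ collapse T
  lift⊆⇒⊆collapse lS⊆T sv = fzero , lS⊆T sv

  lift-⊆⁻ : ∀ {S T} → lift S ⊆ lift T → S ⊆ T
  lift-⊆⁻ lS⊆lT {v} sv = lS⊆lT {v , fzero} sv

mainTheorem13 : ∀ {n m : ℕ} (ends : Fin m → Fin n × Fin n) (outPos inPos : Fin m → ℕ)
                → IsSimple ends → IsOutOrdering ends outPos → IsInOrdering ends inPos
                → (S : Pred (Fin n) 0ℓ)
                → Is2ESCC (Construction.G ends outPos inPos) S
                  ⇔ Is2ESCC (Construction.G̃ ends outPos inPos) (Construction.lift ends outPos inPos S)
mainTheorem13 ends outPos inPos _ _ _ S = mk⇔ to from
  where
  open Construction ends outPos inPos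
  open Lifting ends outPos inPos

  to : Is2ESCC G S → Is2ESCC G̃ (lift S)
  to (h , maximal) =
    lift-Is2ESC h ,
    λ T lS⊆T hT → collapse⊆⇒⊆lift {S} {T} (maximal (collapse T) (lift⊆⇒⊆collapse {S} {T} lS⊆T) (collapse-Is2ESC hT))

  from : Is2ESCC G̃ (lift S) → Is2ESCC G S
  from (h , maximal) =
    Walks.Is2ESC-resp-≐ G (collapse-lift S) (collapse-Is2ESC h) ,
    λ T S⊆T hT → lift-⊆⁻ {T} {S} (λ {x} → maximal (lift T) S⊆T (lift-Is2ESC hT) {x})
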